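{- Let $\mathcal R=(\mathcal F,\Pi,\mu,E,H,R)$ be an EGTRS. Then $\mathcal R$ has property $\alpha$ if and only if every conditional pair in $\mathsf{CCP}(\mathcal R)\cup\mathsf{CVP}^{\to}(\mathcal R)$ is joinable modulo $E$ with respect to $\to_{\mathcal R}$.
   Context: Terms over a signature $\mathcal F$ and countable variables $\mathcal X$; $t|_p$, $t[s]_p$, root position $\Lambda$ standard. A replacement map $\mu$ assigns to each $k$-ary $f$ a set $\mu(f)\subseteq\{1,..,k\}$; active positions: $\mathcal{P}os^\mu(x)=\{\Lambda\}$, $\mathcal{P}os^\mu(f(t_1,..,t_k))=\{\Lambda\}\cup\{i.q\mid i\in\mu(f),q\in\mathcal{P}os^\mu(t_i)\}$; $\mathcal{P}os^\mu_{\mathcal F}(t)$ (resp. $\mathcal{P}os^\mu_x(t)$) are the active positions carrying a function symbol (resp. the variable $x$); $\mathcal{V}ar^\mu(t)$ is the set of variables with an active occurrence. An EGTRS is $\mathcal R=(\mathcal F,\Pi,\mu,E,H,R)$ with $\Pi$ a predicate signature containing binary $=,\to,\to^*$; $E$ conditional equations $s=t\Leftarrow c$; $H$ definite Horn clauses $A\Leftarrow c$ with head predicate not $=,\to,\to^*$; $R$ rules $\ell\to r\Leftarrow c$, $\ell\notin\mathcal X$; each $c$ a finite sequence of atoms; it is assumed that $=$ does not depend on $R$ (a predicate $P$ depends on $R$ if $P\in\{\to,\to^*\}$ or some clause of $E\cup H$ with head predicate $P$ has a body atom whose predicate depends on $R$). $R^{rm}$: $R$ with $\approx$ replaced by new $\approx_{rm}$;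 $H^{rm}$: $H$ with $\approx,\to,\to^*$ replaced by new $\approx_{rm},\to_{rm},\to^*_{rm}$. $\mathsf{Th}^{CR}$: universal closures of (a) reflexivity, symmetry, transitivity of $=$, $x_i=y_i\Rightarrow f(..x_i..)=f(..y_i..)$ ($i\in\mu(f)$), $A_1\wedge..\wedge A_n\Rightarrow s=t$ for $s=t\Leftarrow A_1,..,A_n\in E$; (b) $x\to^*x$, $x\to y\wedge y\to^*z\Rightarrow x\to^*z$, $x_i\to y_i\Rightarrow f(..x_i..)\to f(..y_i..)$ ($i\in\mu(f)$), $A_1\wedge..\wedge A_n\Rightarrow\ell\to r$ for $\ell\to r\Leftarrow A_1,..,A_n\in R^{rm}$; (c) $x\to^*_{ps}x$, $x\to_{ps}y\wedge y\to^*_{ps}z\Rightarrow x\to^*_{ps}z$, $x_i\to_{ps}y_i\Rightarrow f(..x_i..)\to_{ps}f(..y_i..)$, $x=\ell\wedge A_1\wedge..\wedge A_n\Rightarrow x\to_{ps}r$ ($x$ fresh) for each rule of $R^{rm}$; (d) $x\to^*_{rm}x$, $x\to_{rm}y\wedge y\to^*_{rm}z\Rightarrow x\to^*_{rm}z$, $x=x'\wedge x'\to y'\wedge y'=y\Rightarrow x\to_{rm}y$; (e) the clauses of $H^{rm}$. $s\to_{\mathcal R}t$ iff $s\to t$ is deducible from $\mathsf{Th}^{CR}$; $s=_Et$ iff $s=t$ is deducible from (a) plus the clauses of $H$. Property $\alpha$: whenever $t\leftarrow_{\mathcal R}s\to_{\mathcal R}t'$ there are $u,u'$ with $t\to^*_{\mathcal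 R}u$, $t'\to^*_{\mathcal R}u'$, $u=_Eu'$. A conditional pair is $\langle s,t\rangle\Leftarrow A_1,..,A_n$ ($s,t$ terms, $A_i$ atoms). A substitution $\sigma$ satisfies its conditional part if each $\sigma(A_i)$ is deducible from $\mathsf{Th}^{CR}$; the pair is feasible if some $\sigma$ does; it is joinable modulo $E$ w.r.t. $\to_{\mathcal R}$ if for every such $\sigma$ there are $u,u'$ with $\sigma(s)\to^*_{\mathcal R}u$, $\sigma(t)\to^*_{\mathcal R}u'$, $u=_Eu'$. Conditional critical pair (CCP) of variable-disjoint rules $\alpha:s\to t\Leftarrow c$, $\alpha':u\to v\Leftarrow d$ at $p\in\mathcal{P}os^\mu_{\mathcal F}(s)$ such that $s|_p$ and $u$ unify with mgu $\theta$: $\langle\theta(s)[\theta(v)]_p,\theta(t)\rangle\Leftarrow\theta(c),\theta(d)$. $\mathsf{CCP}(\mathcal R)$ is the set of feasible CCPs with $\alpha,\alpha'\in R^{rm}$. Conditional variable pair with parameter $\bowtie$ of a rule $\alpha:s\to t\Leftarrow c$, $x\in\mathcal{V}ar^\mu(s)$, $p\in\mathcal{P}os^\mu_x(s)$, $x'$ fresh: $\langle s[x']_p,t\rangle\Leftarrow x\bowtie x',c$. $\mathsf{CVP}^{\to}(\mathcal R)$ is the set of feasible such pairs with $\bowtie$ the predicate $\to$ and $\alpha\in R^{rm}$. -}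

module Defs where

open import Data.Nat using (ℕ; zero; suc)
open import Data.Fin using (Fin; toℕ)
open import Data.Fin.Subset using (Subset; _∈_)
open import Data.Vec using (Vec; []; _∷_; lookup; _[_]≔_)
open import Data.List using (List; []; _∷_; map; _++_)
open import Data.List.Relation.Unary.All using (All)
open import Data.List.Relation.Unary.Any using (Any)
import Data.List.Membership.Propositional as ListMem
open import Data.Maybe using (Maybe; just; nothing)
open import Data.Product using (Σ; ∃; ∃-syntax; _×_; _,_)
open import Data.Sum using (_⊎_)
open import Relation.Nullary using (¬_)
open import Relation.Binary.PropositionalEquality using (_≡_)
open import Relation.Binary.Construct.Closure.ReflexiveTransitive using (Star)
open import Function.Definitions using (Injective)
open import Function.Base using (_∘_)

-- Function symbols F with arities; the predicate signature
-- Π consists of the three distinguished binary predicates =, →, →*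
-- together with further predicate symbols Π₀ (with arities).

-- positions: lists of 0-based argument indices; [] is the root Λ
Pos : Set
Pos = List ℕ

record Signature : Set₁ where
  field
    F    : Set
    ar   : F → ℕ
    Π₀   : Set
    par  : Π₀ → ℕ

module _ (S : Signature) where
  open Signature S

  data Term : Set where
    var : ℕ → Term
    fun : (f : F) → Vec Term (ar f) → Term

  data Pred : Set where
    eqP rwP rwsP : Pred
    otherP : Π₀ → Pred

  data Atom : Set where
    _≐_ _⟶_ _⟶*_ : Term → Term → Atom
    app : (P : Π₀) → Vec Term (par P) → Atom

  -- Atoms over Π extended with the auxiliary predicates of Th^CR:
  -- →ps, →*ps, →rm, →*rm
  data XAtom : Set where
    _≐_ _⟶_ _⟶*_ : Term → Term → XAtom
    app : (P : Π₀) → Vec Term (par P) → XAtom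
    _⟶ps_ _⟶ps*_ _⟶rm_ _⟶rm*_ : Term → Term → XAtom

  Subst : Set
  Subst = ℕ → Term

module _ {S : Signature} where
  open Signature S

  mutual
    subst : Subst S → Term S → Term S
    subst σ (var x)    = σ x
    subst σ (fun f ts) = fun f (substs σ ts)

    substs : ∀ {n} → Subst S → Vec (Term S) n → Vec (Term S) n
    substs σ []       = []
    substs σ (t ∷ ts) = subst σ t ∷ substs σ ts

  substX : Subst S → XAtom S → XAtom S
  substX σ (s ≐ t)    = subst σ s ≐ subst σ t
  substX σ (s ⟶ t)    = subst σ s ⟶ subst σ t
  substX σ (s ⟶* t)   = subst σ s ⟶* subst σ t
  substX σ (app P ts) = app P (substs σ ts)
  substX σ (s ⟶ps t)  = subst σ s ⟶ps subst σ t
  substX σ (s ⟶ps* t) = subst σ s ⟶ps* subst σ t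
  substX σ (s ⟶rm t)  = subst σ s ⟶rm subst σ t
  substX σ (s ⟶rm* t) = subst σ s ⟶rm* subst σ t

  predOf : Atom S → Pred S
  predOf (_ ≐ _)    = eqP
  predOf (_ ⟶ _)    = rwP
  predOf (_ ⟶* _)   = rwsP
  predOf (app P _)  = otherP P

  emb : Atom S → XAtom S
  emb (s ≐ t)    = s ≐ t
  emb (s ⟶ t)    = s ⟶ t
  emb (s ⟶* t)   = s ⟶* t
  emb (app P ts) = app P ts

  rm : Atom S → XAtom S
  rm (s ≐ t)    = s ≐ t
  rm (s ⟶ t)    = s ⟶rm t
  rm (s ⟶* t)   = s ⟶rm* t
  rm (app P ts) = app P ts

  toFin? : ∀ n → ℕ → Maybe (Fin n)
  toFin? zero    _       = nothing
  toFin? (suc n) zero    = just Fin.zero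
  toFin? (suc n) (suc i) with toFin? n i
  ... | just j  = just (Fin.suc j)
  ... | nothing = nothing

  _∣_ : Term S → Pos → Maybe (Term S)
  t ∣ [] = just t
  var x ∣ (i ∷ q) = nothing
  fun f ts ∣ (i ∷ q) with toFin? (ar f) i
  ... | just j  = lookup ts j ∣ q
  ... | nothing = nothing

  -- t[s]_p  (t unchanged if p is not a position of t)
  _[_]at_ : Term S → Term S → Pos → Term S
  t [ s ]at [] = s
  var x [ s ]at (i ∷ q) = var x
  fun f ts [ s ]at (i ∷ q) with toFin? (ar f) i
  ... | just j  = fun f (ts [ j ]≔ (lookup ts j [ s ]at q))
  ... | nothing = fun f ts

  data _occ_ (x : ℕ) : Term S → Set where
    here  : x occ var x
    there : ∀ {f ts} (i : Fin (ar f)) → x occ lookup ts i → x occ fun f ts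

  argsX : XAtom S → List (Term S)
  argsX (s ≐ t)    = s ∷ t ∷ []
  argsX (s ⟶ t)    = s ∷ t ∷ []
  argsX (s ⟶* t)   = s ∷ t ∷ []
  argsX (app P ts) = Data.Vec.toList ts
  argsX (s ⟶ps t)  = s ∷ t ∷ []
  argsX (s ⟶ps* t) = s ∷ t ∷ []
  argsX (s ⟶rm t)  = s ∷ t ∷ []
  argsX (s ⟶rm* t) = s ∷ t ∷ []

  _occX_ : ℕ → XAtom S → Set
  x occX A = Any (x occ_) (argsX A)

  IsMGU : Subst S → Term S → Term S → Set
  IsMGU θ s t = (subst θ s ≡ subst θ t)
              × (∀ τ → subst τ s ≡ subst τ t → ∃[ ρ ] (∀ x → τ x ≡ subst ρ (θ x)))

  record Clause : Set where
    constructor _⇐_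
    field
      head : XAtom S
      body : List (XAtom S)

  -- Deducibility from a set of clauses T that is closed under instances
  -- (all theories below are given by all instances of their clauses,
  -- i.e. they present universal closures).
  data Ded (T : Clause → Set) : XAtom S → Set where
    by : ∀ {A Bs} → T (A ⇐ Bs) → All (Ded T) Bs → Ded T A

module _ (S : Signature) where
  open Signature S

  record Equation : Set where
    field
      eqL eqR : Term S
      eqC     : List (Atom S)

  record HornClause : Set where
    field
      hpred : Π₀
      hargs : Vec (Term S) (par hpred)
      hbody : List (Atom S)

  record Rule : Set where
    field
      lhs rhs : Term S
      cond    : List (Atom S)

  record RmRule : Set where
    field
      lhs rhs : Term S
      cond    : List (XAtom S)

  IsVar : Term S → Set
  IsVar t = ∃[ x ] (t ≡ var x)

  module _ (E : Equation → Set) (H : HornClause → Set) where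
    open ListMem renaming (_∈_ to _∈L_)
    data DependsOnR : Pred S → Set where
      dep-rw  : DependsOnR rwP
      dep-rws : DependsOnR rwsP
      dep-E   : ∀ e → E e → ∀ {A} → A ∈L Equation.eqC e →
                DependsOnR (predOf A) → DependsOnR eqP
      dep-H   : ∀ h → H h → ∀ {A} → A ∈L HornClause.hbody h →
                DependsOnR (predOf A) → DependsOnR (otherP (HornClause.hpred h))

  record EGTRS : Set₁ where
    field
      μ : (f : F) → Subset (ar f)
      E : Equation → Set
      H : HornClause → Set
      R : Rule → Set
      lhs-nonvar : ∀ ρ → R ρ → ¬ IsVar (Rule.lhs ρ)
      eq-indep   : ¬ DependsOnR E H eqP

module _ {S : Signature} where
  open Signature S

  toRm : Rule S → RmRule S
  toRm ρ = record { lhs = Rule.lhs ρ ; rhs = Rule.rhs ρ ; cond = map rm (Rule.cond ρ) }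

  substRm : Subst S → RmRule S → RmRule S
  substRm σ α = record { lhs = subst σ (RmRule.lhs α) ; rhs = subst σ (RmRule.rhs α)
                       ; cond = map (substX σ) (RmRule.cond α) }

  _occR_ : ℕ → RmRule S → Set
  x occR α = (x occ RmRule.lhs α) ⊎ (x occ RmRule.rhs α) ⊎ Any (x occX_) (RmRule.cond α)

module _ {S : Signature} (𝓡 : EGTRS S) where
  open Signature S
  open EGTRS 𝓡

  data Active : Term S → Pos → Set where
    Λ   : ∀ {t} → Active t []
    arg : ∀ {f ts q} (i : Fin (ar f)) → i ∈ μ f → Active (lookup ts i) q →
          Active (fun f ts) (toℕ i ∷ q)

  ActiveFunPos : Term S → Pos → Set
  ActiveFunPos t p = Active t p × ∃[ f ] ∃[ ts ] (t ∣ p ≡ just (fun f ts))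

  ActiveVarPos : ℕ → Term S → Pos → Set
  ActiveVarPos x t p = Active t p × (t ∣ p ≡ just (var x))

  data ThA : Clause → Set where
    eq-refl  : ∀ t → ThA ((t ≐ t) ⇐ [])
    eq-sym   : ∀ s t → ThA ((t ≐ s) ⇐ ((s ≐ t) ∷ []))
    eq-trans : ∀ s t u → ThA ((s ≐ u) ⇐ ((s ≐ t) ∷ (t ≐ u) ∷ []))
    eq-cong  : ∀ f ts (i : Fin (ar f)) → i ∈ μ f → ∀ u →
               ThA ((fun f ts ≐ fun f (ts [ i ]≔ u)) ⇐ ((lookup ts i ≐ u) ∷ []))
    eq-E     : ∀ e → E e → ∀ σ →
               ThA ((subst σ (Equation.eqL e) ≐ subst σ (Equation.eqR e))
                    ⇐ map (substX σ ∘ emb) (Equation.eqC e))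

  data ThCR : Clause → Set where
    a        : ∀ {c} → ThA c → ThCR c
    rws-refl : ∀ t → ThCR ((t ⟶* t) ⇐ [])
    rws-step : ∀ s t u → ThCR ((s ⟶* u) ⇐ ((s ⟶ t) ∷ (t ⟶* u) ∷ []))
    rw-cong  : ∀ f ts (i : Fin (ar f)) → i ∈ μ f → ∀ u →
               ThCR ((fun f ts ⟶ fun f (ts [ i ]≔ u)) ⇐ ((lookup ts i ⟶ u) ∷ []))
    rw-rule  : ∀ ρ → R ρ → ∀ σ →
               ThCR ((subst σ (Rule.lhs ρ) ⟶ subst σ (Rule.rhs ρ))
                     ⇐ map (substX σ ∘ rm) (Rule.cond ρ))
    ps*-refl : ∀ t → ThCR ((t ⟶ps* t) ⇐ [])
    ps*-step : ∀ s t u → ThCR ((s ⟶ps* u) ⇐ ((s ⟶ps t) ∷ (t ⟶ps* u) ∷ []))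
    ps-cong  : ∀ f ts (i : Fin (ar f)) → ∀ u →
               ThCR ((fun f ts ⟶ps fun f (ts [ i ]≔ u)) ⇐ ((lookup ts i ⟶ps u) ∷ []))
    ps-rule  : ∀ ρ → R ρ → ∀ σ t →
               ThCR ((t ⟶ps subst σ (Rule.rhs ρ))
                     ⇐ ((t ≐ subst σ (Rule.lhs ρ)) ∷ map (substX σ ∘ rm) (Rule.cond ρ)))
    rm*-refl : ∀ t → ThCR ((t ⟶rm* t) ⇐ [])
    rm*-step : ∀ s t u → ThCR ((s ⟶rm* u) ⇐ ((s ⟶rm t) ∷ (t ⟶rm* u) ∷ []))
    rm-def   : ∀ s s' t' t → ThCR ((s ⟶rm t) ⇐ ((s ≐ s') ∷ (s' ⟶ t') ∷ (t' ≐ t) ∷ []))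
    hrm      : ∀ h → H h → ∀ σ →
               ThCR ((app (HornClause.hpred h) (substs σ (HornClause.hargs h)))
                     ⇐ map (substX σ ∘ rm) (HornClause.hbody h))

  data ThE : Clause → Set where
    a  : ∀ {c} → ThA c → ThE c
    hc : ∀ h → H h → ∀ σ →
         ThE ((app (HornClause.hpred h) (substs σ (HornClause.hargs h)))
              ⇐ map (substX σ ∘ emb) (HornClause.hbody h))

  _→R_ : Term S → Term S → Set
  s →R t = Ded ThCR (s ⟶ t)

  _→R*_ : Term S → Term S → Set
  _→R*_ = Star _→R_

  _=E_ : Term S → Term S → Set
  s =E t = Ded ThE (s ≐ t)

  PropertyAlpha : Set
  PropertyAlpha = ∀ s t t' → s →R t → s →R t' →
                  ∃[ u ] ∃[ u' ] (t →R* u × t' →R* u' × u =E u')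

  record CondPair : Set where
    constructor ⟨_,_⟩⇐_
    field
      cpL cpR : Term S
      cpC     : List (XAtom S)

  Satisfies : Subst S → CondPair → Set
  Satisfies σ cp = All (λ A → Ded ThCR (substX σ A)) (CondPair.cpC cp)

  Feasible : CondPair → Set
  Feasible cp = ∃[ σ ] Satisfies σ cp

  JoinableModE : CondPair → Set
  JoinableModE cp = ∀ σ → Satisfies σ cp →
    ∃[ u ] ∃[ u' ] (subst σ (CondPair.cpL cp) →R* u × subst σ (CondPair.cpR cp) →R* u' × u =E u')

  data InCCP : CondPair → Set where
    ccp : ∀ ρ₁ ρ₂ → R ρ₁ → R ρ₂ →
          ∀ (π₁ π₂ : ℕ → ℕ) → Injective _≡_ _≡_ π₁ → Injective _≡_ _≡_ π₂ →
          let α  = substRm (var ∘ π₁) (toRm ρ₁)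
              α' = substRm (var ∘ π₂) (toRm ρ₂) in
          (∀ x → x occR α → ¬ (x occR α')) →
          ∀ p w → ActiveFunPos (RmRule.lhs α) p → RmRule.lhs α ∣ p ≡ just w →
          ∀ θ → IsMGU θ w (RmRule.lhs α') →
          let cp = ⟨ subst θ (RmRule.lhs α) [ subst θ (RmRule.rhs α') ]at p
                   , subst θ (RmRule.rhs α) ⟩⇐
                   (map (substX θ) (RmRule.cond α) ++ map (substX θ) (RmRule.cond α')) in
          Feasible cp → InCCP cp

  data InCVP : CondPair → Set where
    cvp : ∀ ρ → R ρ →
          let α = toRm ρ in
          ∀ x p → ActiveVarPos x (RmRule.lhs α) p →
          ∀ x' → ¬ (x' occR α) →
          let cp = ⟨ RmRule.lhs α [ var x' ]at p , RmRule.rhs α ⟩⇐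
                   ((var x ⟶ var x') ∷ RmRule.cond α) in
          Feasible cp → InCVP cp

  AllPairsJoinable : Set
  AllPairsJoinable = ∀ cp → (InCCP cp ⊎ InCVP cp) → JoinableModE cp

-- An instance of a feasible critical or variable pair is itself a peak, which gives one
-- direction.  For the other, →_R is presented inductively by root steps and steps under active
-- arguments, and a peak t ← s → t′ is analysed by induction on the left step.  Steps in distinct
-- arguments commute and steps in the same argument are joined inductively.  Against a root step
-- with ℓ → r, the other step either rewrites σℓ at an active non-variable position p of ℓ, and
-- then renaming the rules apart and taking a most general unifier (Robinson's algorithm) shows
-- the peak to be an instance of a critical pair, or it rewrites inside σx for an active
-- occurrence of x in ℓ, and the peak is an instance of the variable pair with parameter →.

module Submission where

open import Defs
open import Algebra.Properties.CommutativeSemigroup using (interchange)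
open import Data.Empty using (⊥-elim)
open import Data.Fin as Fin using (Fin; toℕ)
import Data.Fin.Subset as Subset
open import Data.List as List using (List; []; _∷_; _++_; map; concatMap; length; filter)
open import Data.List.Extrema.Nat using (max; xs≤max)
open import Data.List.Membership.Propositional using (_∈_; _∉_)
open import Data.List.Membership.Propositional.Properties using (∈-filter⁺; ∈-++⁺ˡ; ∈-++⁺ʳ)
open import Data.List.Properties using (filter-notAll)
open import Data.List.Relation.Unary.All as All using (All; []; _∷_)
import Data.List.Relation.Unary.All.Properties as All
open import Data.List.Relation.Unary.Any as Any using (Any; here; there)
import Data.List.Relation.Unary.Any.Properties as Any
open import Data.Maybe using (just)
open import Data.Nat using (ℕ; zero; suc; _+_; _≤_; _<_; s≤s; z≤n)
open import Data.Nat.Properties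
  using (_≟_; ≤-refl; ≤-trans; ≤-pred; <-irrefl; <-≤-trans; 1+n≰n; n<1+n; m≤n⇒m≤1+n; m≤m+n; m≤n+m; m<n+m;
         +-assoc; +-mono-<; +-monoˡ-<; +-commutativeSemigroup; suc-injective)
open import Data.Product as Product using (∃-syntax; _×_; _,_; proj₁; proj₂)
open import Data.Sum using (_⊎_; inj₁; inj₂)
open import Data.Vec as Vec using (Vec; []; _∷_; lookup; _[_]≔_; toList)
import Data.Vec.Properties as Vec
open import Function.Base using (_∘_; id)
open import Function.Bundles using (_⇔_; mk⇔)
open import Function.Definitions using (Injective)
open import Relation.Binary.PropositionalEquality as ≡ using (_≡_; _≢_; _≗_; refl; sym; trans; cong; cong₂)
open import Relation.Nullary using (¬_; yes; no; ¬?)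
open import Relation.Binary.Construct.Closure.ReflexiveTransitive using (ε; _◅_; gmap)

module Terms {S : Signature} where
  open Signature S

  infixr 9 _∘ₛ_
  _∘ₛ_ : Subst S → Subst S → Subst S
  σ ∘ₛ τ = subst σ ∘ τ

  substs≡map : ∀ (σ : Subst S) {n} (ts : Vec (Term S) n) → substs σ ts ≡ Vec.map (subst σ) ts
  substs≡map σ []       = refl
  substs≡map σ (t ∷ ts) = cong (subst σ t ∷_) (substs≡map σ ts)

  lookup-substs : ∀ (σ : Subst S) {n} (ts : Vec (Term S) n) i →
                  lookup (substs σ ts) i ≡ subst σ (lookup ts i)
  lookup-substs σ ts i = trans (cong (λ us → lookup us i) (substs≡map σ ts)) (Vec.lookup-map i (subst σ) ts)

  substs-[]≔ : ∀ (σ : Subst S) {n} (ts : Vec (Term S) n) i u →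
               substs σ (ts [ i ]≔ u) ≡ substs σ ts [ i ]≔ subst σ u
  substs-[]≔ σ ts i u = begin
    substs σ (ts [ i ]≔ u)               ≡⟨ substs≡map σ _ ⟩
    Vec.map (subst σ) (ts [ i ]≔ u)      ≡⟨ Vec.map-[]≔ (subst σ) ts i ⟩
    Vec.map (subst σ) ts [ i ]≔ subst σ u ≡⟨ cong (_[ i ]≔ subst σ u) (sym (substs≡map σ ts)) ⟩
    substs σ ts [ i ]≔ subst σ u          ∎
    where open ≡.≡-Reasoning

  toList-substs : ∀ (σ : Subst S) {n} (ts : Vec (Term S) n) →
                  toList (substs σ ts) ≡ map (subst σ) (toList ts)
  toList-substs σ ts = trans (cong toList (substs≡map σ ts)) (Vec.toList-map (subst σ) ts)

  mutual
    subst-cong-occ : ∀ {σ τ : Subst S} t → (∀ x → x occ t → σ x ≡ τ x) → subst σ t ≡ subst τ t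
    subst-cong-occ (var x)    h = h x here
    subst-cong-occ (fun f ts) h = cong (fun f) (substs-cong-occ ts (λ x i → h x ∘ there i))

    substs-cong-occ : ∀ {σ τ : Subst S} {n} (ts : Vec (Term S) n) →
                      (∀ x i → x occ lookup ts i → σ x ≡ τ x) → substs σ ts ≡ substs τ ts
    substs-cong-occ []       h = refl
    substs-cong-occ (t ∷ ts) h = cong₂ _∷_ (subst-cong-occ t (λ x → h x Fin.zero))
                                           (substs-cong-occ ts (λ x → h x ∘ Fin.suc))

  subst-cong : ∀ {σ τ : Subst S} → σ ≗ τ → ∀ t → subst σ t ≡ subst τ t
  subst-cong h t = subst-cong-occ t (λ x _ → h x)

  mutual
    subst-∘ₛ : ∀ (σ τ : Subst S) t → subst (σ ∘ₛ τ) t ≡ subst σ (subst τ t)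
    subst-∘ₛ σ τ (var x)    = refl
    subst-∘ₛ σ τ (fun f ts) = cong (fun f) (substs-∘ₛ σ τ ts)

    substs-∘ₛ : ∀ (σ τ : Subst S) {n} (ts : Vec (Term S) n) → substs (σ ∘ₛ τ) ts ≡ substs σ (substs τ ts)
    substs-∘ₛ σ τ []       = refl
    substs-∘ₛ σ τ (t ∷ ts) = cong₂ _∷_ (subst-∘ₛ σ τ t) (substs-∘ₛ σ τ ts)

  subst-∘ₛ-∘ₛ : ∀ (σ θ κ : Subst S) t → subst ((σ ∘ₛ θ) ∘ₛ κ) t ≡ subst σ (subst θ (subst κ t))
  subst-∘ₛ-∘ₛ σ θ κ t = trans (subst-∘ₛ (σ ∘ₛ θ) κ t) (subst-∘ₛ σ θ (subst κ t))

  mutual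
    occ-subst⁻ : ∀ {σ : Subst S} {y} t → y occ subst σ t → ∃[ z ] (z occ t × y occ σ z)
    occ-subst⁻ (var x)    o           = x , here , o
    occ-subst⁻ (fun f ts) (there i o) = Product.map₂ (Product.map₁ (there i)) (occs-subst⁻ ts i o)

    occs-subst⁻ : ∀ {σ : Subst S} {y n} (ts : Vec (Term S) n) i →
                  y occ lookup (substs σ ts) i → ∃[ z ] (z occ lookup ts i × y occ σ z)
    occs-subst⁻ (t ∷ ts) Fin.zero    o = occ-subst⁻ t o
    occs-subst⁻ (t ∷ ts) (Fin.suc i) o = occs-subst⁻ ts i o

  fun-injectiveˡ : ∀ {f g} {ts : Vec (Term S) (ar f)} {us : Vec (Term S) (ar g)} → fun f ts ≡ fun g us → f ≡ g
  fun-injectiveˡ refl = refl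

  fun-injectiveʳ : ∀ {f} {ts us : Vec (Term S) (ar f)} → fun f ts ≡ fun f us → ts ≡ us
  fun-injectiveʳ refl = refl

  occ-var : ∀ {x y} → x occ var {S} y → x ≡ y
  occ-var here = refl

  _[_↦_] : Subst S → ℕ → Term S → Subst S
  (σ [ x ↦ t ]) y with y ≟ x
  ... | yes _ = t
  ... | no  _ = σ y

  [↦]-≡ : ∀ σ x t → (σ [ x ↦ t ]) x ≡ t
  [↦]-≡ σ x t with x ≟ x
  ... | yes _   = refl
  ... | no  x≢x = ⊥-elim (x≢x refl)

  [↦]-≢ : ∀ σ x t {y} → y ≢ x → (σ [ x ↦ t ]) y ≡ σ y
  [↦]-≢ σ x t {y} y≢x with y ≟ x
  ... | yes y≡x = ⊥-elim (y≢x y≡x)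
  ... | no  _   = refl

  mutual
    size : Term S → ℕ
    size (var x)    = 1
    size (fun f ts) = suc (sizes ts)

    sizes : ∀ {n} → Vec (Term S) n → ℕ
    sizes []       = 0
    sizes (t ∷ ts) = size t + sizes ts

  size-positive : ∀ t → 0 < size t
  size-positive (var x)    = s≤s z≤n
  size-positive (fun f ts) = s≤s z≤n

  mutual
    size-occ : ∀ {σ : Subst S} {x} t → x occ t → size (σ x) ≤ size (subst σ t)
    size-occ (var x)    here        = ≤-refl
    size-occ (fun f ts) (there i o) = m≤n⇒m≤1+n (sizes-occ ts i o)

    sizes-occ : ∀ {σ : Subst S} {x n} (ts : Vec (Term S) n) i →
                x occ lookup ts i → size (σ x) ≤ sizes (substs σ ts)
    sizes-occ (t ∷ ts) Fin.zero    o = ≤-trans (size-occ t o) (m≤m+n _ _)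
    sizes-occ (t ∷ ts) (Fin.suc i) o = ≤-trans (sizes-occ ts i o) (m≤n+m _ _)

  occurs-check : ∀ {σ : Subst S} {x f ts} → x occ fun f ts → σ x ≢ subst σ (fun f ts)
  occurs-check {ts = ts} (there i o) σx≡σt = <-irrefl (cong size σx≡σt) (s≤s (sizes-occ ts i o))

  toFin?-toℕ : ∀ {n} (i : Fin n) → toFin? {S} n (toℕ i) ≡ just i
  toFin?-toℕ Fin.zero                        = refl
  toFin?-toℕ {suc n} (Fin.suc i) rewrite toFin?-toℕ {n} i = refl

  ∣-arg : ∀ {f} (ts : Vec (Term S) (ar f)) i q → fun f ts ∣ (toℕ i ∷ q) ≡ lookup ts i ∣ q
  ∣-arg {f} ts i q rewrite toFin?-toℕ {ar f} i = refl

  []at-arg : ∀ {f} (ts : Vec (Term S) (ar f)) i q s →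
             fun f ts [ s ]at (toℕ i ∷ q) ≡ fun f (ts [ i ]≔ (lookup ts i [ s ]at q))
  []at-arg {f} ts i q s rewrite toFin?-toℕ {ar f} i = refl

  substX-∘ₛ : ∀ (σ τ : Subst S) A → substX (σ ∘ₛ τ) A ≡ substX σ (substX τ A)
  substX-∘ₛ σ τ (s ≐ t)    = cong₂ _≐_ (subst-∘ₛ σ τ s) (subst-∘ₛ σ τ t)
  substX-∘ₛ σ τ (s ⟶ t)    = cong₂ _⟶_ (subst-∘ₛ σ τ s) (subst-∘ₛ σ τ t)
  substX-∘ₛ σ τ (s ⟶* t)   = cong₂ _⟶*_ (subst-∘ₛ σ τ s) (subst-∘ₛ σ τ t)
  substX-∘ₛ σ τ (app P ts) = cong (app P) (substs-∘ₛ σ τ ts)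
  substX-∘ₛ σ τ (s ⟶ps t)  = cong₂ _⟶ps_ (subst-∘ₛ σ τ s) (subst-∘ₛ σ τ t)
  substX-∘ₛ σ τ (s ⟶ps* t) = cong₂ _⟶ps*_ (subst-∘ₛ σ τ s) (subst-∘ₛ σ τ t)
  substX-∘ₛ σ τ (s ⟶rm t)  = cong₂ _⟶rm_ (subst-∘ₛ σ τ s) (subst-∘ₛ σ τ t)
  substX-∘ₛ σ τ (s ⟶rm* t) = cong₂ _⟶rm*_ (subst-∘ₛ σ τ s) (subst-∘ₛ σ τ t)

  private
    binary-cong-occ : ∀ {σ τ : Subst S} (c : Term S → Term S → XAtom S) s t →
                      (∀ x → Any (x occ_) (s ∷ t ∷ []) → σ x ≡ τ x) →
                      c (subst σ s) (subst σ t) ≡ c (subst τ s) (subst τ t)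
    binary-cong-occ c s t h =
      cong₂ c (subst-cong-occ s (λ x → h x ∘ here)) (subst-cong-occ t (λ x o → h x (there (here o))))

    lookup-occ⇒any : ∀ {x n} (ts : Vec (Term S) n) i → x occ lookup ts i → Any (x occ_) (toList ts)
    lookup-occ⇒any (t ∷ ts) Fin.zero    o = here o
    lookup-occ⇒any (t ∷ ts) (Fin.suc i) o = there (lookup-occ⇒any ts i o)

  substX-cong-occ : ∀ {σ τ : Subst S} A → (∀ x → x occX A → σ x ≡ τ x) → substX σ A ≡ substX τ A
  substX-cong-occ (s ≐ t)    = binary-cong-occ _≐_ s t
  substX-cong-occ (s ⟶ t)    = binary-cong-occ _⟶_ s t
  substX-cong-occ (s ⟶* t)   = binary-cong-occ _⟶*_ s t
  substX-cong-occ (app P ts) h = cong (app P) (substs-cong-occ ts (λ x i → h x ∘ lookup-occ⇒any ts i))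
  substX-cong-occ (s ⟶ps t)  = binary-cong-occ _⟶ps_ s t
  substX-cong-occ (s ⟶ps* t) = binary-cong-occ _⟶ps*_ s t
  substX-cong-occ (s ⟶rm t)  = binary-cong-occ _⟶rm_ s t
  substX-cong-occ (s ⟶rm* t) = binary-cong-occ _⟶rm*_ s t

  substX-cong : ∀ {σ τ : Subst S} → σ ≗ τ → ∀ A → substX σ A ≡ substX τ A
  substX-cong h A = substX-cong-occ A (λ x _ → h x)

  argsX-substX : ∀ (σ : Subst S) A → argsX (substX σ A) ≡ map (subst σ) (argsX A)
  argsX-substX σ (s ≐ t)    = refl
  argsX-substX σ (s ⟶ t)    = refl
  argsX-substX σ (s ⟶* t)   = refl
  argsX-substX σ (app P ts) = toList-substs σ ts
  argsX-substX σ (s ⟶ps t)  = refl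
  argsX-substX σ (s ⟶ps* t) = refl
  argsX-substX σ (s ⟶rm t)  = refl
  argsX-substX σ (s ⟶rm* t) = refl

  occX-substX⁻ : ∀ {σ : Subst S} {y} A → y occX substX σ A → ∃[ z ] (y occ σ z)
  occX-substX⁻ {σ} {y} A o
    with t , o′ ← Any.satisfied (Any.map⁻ (≡.subst (Any (y occ_)) (argsX-substX σ A) o))
    = Product.map₂ proj₂ (occ-subst⁻ t o′)

  occR-substRm⁻ : ∀ {σ : Subst S} {x} α → x occR substRm σ α → ∃[ z ] (x occ σ z)
  occR-substRm⁻ α (inj₁ o)        = Product.map₂ proj₂ (occ-subst⁻ (RmRule.lhs α) o)
  occR-substRm⁻ α (inj₂ (inj₁ o)) = Product.map₂ proj₂ (occ-subst⁻ (RmRule.rhs α) o)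
  occR-substRm⁻ α (inj₂ (inj₂ o)) with A , o′ ← Any.satisfied (Any.map⁻ o) = occX-substX⁻ A o′

  mutual
    vars : Term S → List ℕ
    vars (var x)    = x ∷ []
    vars (fun f ts) = varsᵛ ts

    varsᵛ : ∀ {n} → Vec (Term S) n → List ℕ
    varsᵛ []       = []
    varsᵛ (t ∷ ts) = vars t ++ varsᵛ ts

  mutual
    occ⇒∈vars : ∀ {x} t → x occ t → x ∈ vars t
    occ⇒∈vars (var x)    here        = here refl
    occ⇒∈vars (fun f ts) (there i o) = occ⇒∈varsᵛ ts i o

    occ⇒∈varsᵛ : ∀ {x n} (ts : Vec (Term S) n) i → x occ lookup ts i → x ∈ varsᵛ ts
    occ⇒∈varsᵛ (t ∷ ts) Fin.zero    o = ∈-++⁺ˡ (occ⇒∈vars t o)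
    occ⇒∈varsᵛ (t ∷ ts) (Fin.suc i) o = ∈-++⁺ʳ (vars t) (occ⇒∈varsᵛ ts i o)

  fresh : List ℕ → ℕ
  fresh xs = suc (max 0 xs)

  fresh-∉ : ∀ xs → fresh xs ∉ xs
  fresh-∉ xs fresh∈xs = 1+n≰n (All.lookup (xs≤max 0 xs) fresh∈xs)

  varsR : RmRule S → List ℕ
  varsR α = vars (RmRule.lhs α) ++ vars (RmRule.rhs α) ++ concatMap (concatMap vars ∘ argsX) (RmRule.cond α)

  occR⇒∈varsR : ∀ {x} α → x occR α → x ∈ varsR α
  occR⇒∈varsR α (inj₁ o)        = ∈-++⁺ˡ (occ⇒∈vars _ o)
  occR⇒∈varsR α (inj₂ (inj₁ o)) = ∈-++⁺ʳ (vars (RmRule.lhs α)) (∈-++⁺ˡ (occ⇒∈vars _ o))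
  occR⇒∈varsR α (inj₂ (inj₂ o)) =
    ∈-++⁺ʳ (vars (RmRule.lhs α)) (∈-++⁺ʳ (vars (RmRule.rhs α))
      (Any.concatMap⁺ _ (Any.map (Any.concatMap⁺ vars ∘ Any.map (occ⇒∈vars _)) o)))

  fresh-var : ∀ (α : RmRule S) → ∃[ x ] ¬ x occR α
  fresh-var α = fresh (varsR α) , fresh-∉ (varsR α) ∘ occR⇒∈varsR α

module Unification {S : Signature} where
  open Signature S
  open Terms

  Equations : Set
  Equations = List (Term S × Term S)

  _unifies_ : Subst S → Equations → Set
  σ unifies E = All (λ e → subst σ (proj₁ e) ≡ subst σ (proj₂ e)) E

  _≼_ : Subst S → Subst S → Set
  θ ≼ τ = ∃[ ρ ] (∀ x → τ x ≡ subst ρ (θ x))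

  IsMGUᴱ : Subst S → Equations → Set
  IsMGUᴱ θ E = θ unifies E × (∀ τ → τ unifies E → θ ≼ τ)

  HasMGU : Equations → Set
  HasMGU E = ∃[ θ ] IsMGUᴱ θ E

  _occᴱ_ : ℕ → Equations → Set
  x occᴱ E = Any (λ e → x occ proj₁ e ⊎ x occ proj₂ e) E

  _⟨_⟩ : Equations → Subst S → Equations
  E ⟨ σ ⟩ = map (Product.map (subst σ) (subst σ)) E

  zipᴱ : ∀ {n} → Vec (Term S) n → Vec (Term S) n → Equations
  zipᴱ []       []       = []
  zipᴱ (t ∷ ts) (u ∷ us) = (t , u) ∷ zipᴱ ts us

  sizeᴱ : Equations → ℕ
  sizeᴱ []            = 0
  sizeᴱ ((l , r) ∷ E) = size l + size r + sizeᴱ E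

  unifies-cong : ∀ {σ τ} → σ ≗ τ → ∀ {E} → σ unifies E → τ unifies E
  unifies-cong σ≗τ = All.map λ {(l , r)} e → trans (sym (subst-cong σ≗τ l)) (trans e (subst-cong σ≗τ r))

  unifies-⟨⟩⁺ : ∀ {θ σ E} → (θ ∘ₛ σ) unifies E → θ unifies (E ⟨ σ ⟩)
  unifies-⟨⟩⁺ {θ} {σ} = All.map⁺ ∘ All.map λ {(l , r)} e → trans (sym (subst-∘ₛ θ σ l)) (trans e (subst-∘ₛ θ σ r))

  unifies-⟨⟩⁻ : ∀ {θ σ} E → θ unifies (E ⟨ σ ⟩) → (θ ∘ₛ σ) unifies E
  unifies-⟨⟩⁻ {θ} {σ} E =
    All.map (λ {(l , r)} e → trans (subst-∘ₛ θ σ l) (trans e (sym (subst-∘ₛ θ σ r)))) ∘ All.map⁻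

  unifies-zip⁺ : ∀ {τ n} (ts us : Vec (Term S) n) → substs τ ts ≡ substs τ us → τ unifies zipᴱ ts us
  unifies-zip⁺ []       []       _ = []
  unifies-zip⁺ (t ∷ ts) (u ∷ us) e = Vec.∷-injectiveˡ e ∷ unifies-zip⁺ ts us (Vec.∷-injectiveʳ e)

  unifies-zip⁻ : ∀ {τ n} (ts us : Vec (Term S) n) → τ unifies zipᴱ ts us → substs τ ts ≡ substs τ us
  unifies-zip⁻ []       []       []       = refl
  unifies-zip⁻ (t ∷ ts) (u ∷ us) (e ∷ es) = cong₂ _∷_ e (unifies-zip⁻ ts us es)

  occᴱ-⟨⟩⁻ : ∀ {σ y} E → y occᴱ (E ⟨ σ ⟩) → ∃[ z ] (z occᴱ E × y occ σ z)
  occᴱ-⟨⟩⁻ ((l , r) ∷ E) (here (inj₁ o)) = Product.map₂ (Product.map₁ (Any.here ∘ inj₁)) (occ-subst⁻ l o)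
  occᴱ-⟨⟩⁻ ((l , r) ∷ E) (here (inj₂ o)) = Product.map₂ (Product.map₁ (Any.here ∘ inj₂)) (occ-subst⁻ r o)
  occᴱ-⟨⟩⁻ ((l , r) ∷ E) (there o)       = Product.map₂ (Product.map₁ Any.there) (occᴱ-⟨⟩⁻ E o)

  occᴱ-zip⁻ : ∀ {y n} (ts us : Vec (Term S) n) → y occᴱ zipᴱ ts us → ∃[ i ] (y occ lookup ts i ⊎ y occ lookup us i)
  occᴱ-zip⁻ []       []       ()
  occᴱ-zip⁻ (t ∷ ts) (u ∷ us) (here o)  = Fin.zero , o
  occᴱ-zip⁻ (t ∷ ts) (u ∷ us) (there o) = Product.map Fin.suc id (occᴱ-zip⁻ ts us o)

  sizeᴱ-++ : ∀ E F → sizeᴱ (E ++ F) ≡ sizeᴱ E + sizeᴱ F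
  sizeᴱ-++ []            F = refl
  sizeᴱ-++ ((l , r) ∷ E) F = trans (cong (size l + size r +_) (sizeᴱ-++ E F)) (sym (+-assoc (size l + size r) _ _))

  sizeᴱ-zip : ∀ {n} (ts us : Vec (Term S) n) → sizeᴱ (zipᴱ ts us) ≡ sizes ts + sizes us
  sizeᴱ-zip []       []       = refl
  sizeᴱ-zip (t ∷ ts) (u ∷ us) =
    trans (cong (size t + size u +_) (sizeᴱ-zip ts us))
          (interchange +-commutativeSemigroup (size t) (size u) (sizes ts) (sizes us))

  sizeᴱ-tail : ∀ l r E → sizeᴱ E < sizeᴱ ((l , r) ∷ E)
  sizeᴱ-tail l r E = m<n+m (sizeᴱ E) (<-≤-trans (size-positive l) (m≤m+n (size l) (size r)))

  sizeᴱ-decompose : ∀ {f} (ts us : Vec (Term S) (ar f)) E →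
                    sizeᴱ (zipᴱ ts us ++ E) < sizeᴱ ((fun f ts , fun f us) ∷ E)
  sizeᴱ-decompose ts us E rewrite sizeᴱ-++ (zipᴱ ts us) E | sizeᴱ-zip ts us =
    +-monoˡ-< (sizeᴱ E) (+-mono-< (n<1+n (sizes ts)) (n<1+n (sizes us)))

  ≼-∘ₛ : ∀ {θ τ} σ → θ ≼ τ → (θ ∘ₛ σ) ≼ (τ ∘ₛ σ)
  ≼-∘ₛ {θ} σ (ρ , τ≗ρθ) = ρ , λ y → trans (subst-cong τ≗ρθ (σ y)) (subst-∘ₛ ρ θ (σ y))

  absorb : ∀ {τ : Subst S} {x t} → τ x ≡ subst τ t → τ ∘ₛ (var [ x ↦ t ]) ≗ τ
  absorb {x = x} τx≡τt y with y ≟ x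
  ... | yes refl = sym τx≡τt
  ... | no  _    = refl

  delete-mgu : ∀ {θ t} E → IsMGUᴱ θ E → IsMGUᴱ θ ((t , t) ∷ E)
  delete-mgu E (θ-unifies , θ-general) = refl ∷ θ-unifies , λ τ → θ-general τ ∘ All.tail

  orient-mgu : ∀ {θ l r} E → IsMGUᴱ θ ((l , r) ∷ E) → IsMGUᴱ θ ((r , l) ∷ E)
  orient-mgu E (e ∷ θ-unifies , θ-general) = sym e ∷ θ-unifies , λ { τ (e′ ∷ es) → θ-general τ (sym e′ ∷ es) }

  decompose-mgu : ∀ {θ f} (ts us : Vec (Term S) (ar f)) E →
                  IsMGUᴱ θ (zipᴱ ts us ++ E) → IsMGUᴱ θ ((fun f ts , fun f us) ∷ E)
  decompose-mgu {f = f} ts us E (θ-unifies , θ-general) =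
    cong (fun f) (unifies-zip⁻ ts us (All.++⁻ˡ _ θ-unifies)) ∷ All.++⁻ʳ _ θ-unifies ,
    λ { τ (e ∷ es) → θ-general τ (All.++⁺ (unifies-zip⁺ ts us (fun-injectiveʳ e)) es) }

  eliminate-mgu : ∀ {θ x t} E → ¬ x occ t → IsMGUᴱ θ (E ⟨ var [ x ↦ t ] ⟩) →
                  IsMGUᴱ (θ ∘ₛ var [ x ↦ t ]) ((var x , t) ∷ E)
  eliminate-mgu {θ} {x} {t} E x∉t (θ-unifies , θ-general) = unifies-x ∷ unifies-⟨⟩⁻ E θ-unifies , general
    where
    σ : Subst S
    σ = var [ x ↦ t ]

    unifies-x : subst θ (σ x) ≡ subst (θ ∘ₛ σ) t
    unifies-x = begin
      subst θ (σ x)     ≡⟨ cong (subst θ) ([↦]-≡ var x t) ⟩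
      subst θ t         ≡⟨ subst-cong-occ t (λ y y∈t → cong (subst θ) (sym ([↦]-≢ var x t λ { refl → x∉t y∈t }))) ⟩
      subst (θ ∘ₛ σ) t  ∎
      where open ≡.≡-Reasoning

    general : ∀ τ → τ unifies ((var x , t) ∷ E) → (θ ∘ₛ σ) ≼ τ
    general τ (τx≡τt ∷ τ-unifies)
      with ρ , τσ≗ρθσ ← ≼-∘ₛ σ (θ-general τ (unifies-⟨⟩⁺ (unifies-cong (sym ∘ absorb τx≡τt) τ-unifies)))
      = ρ , λ y → trans (sym (absorb τx≡τt y)) (τσ≗ρθσ y)

  _∖_ : List ℕ → ℕ → List ℕ
  V ∖ x = filter (λ y → ¬? (y ≟ x)) V

  ∖-shorter : ∀ {x V} → x ∈ V → length (V ∖ x) < length V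
  ∖-shorter {x} {V} x∈V = filter-notAll (λ y → ¬? (y ≟ x)) V (Any.map (λ x≡y y≢x → y≢x (sym x≡y)) x∈V)

  ∈-∖ : ∀ {x y V} → y ∈ V → y ≢ x → y ∈ V ∖ x
  ∈-∖ {x} = ∈-filter⁺ (λ y → ¬? (y ≟ x))

  _⊆ᵛ_ : Equations → List ℕ → Set
  E ⊆ᵛ V = ∀ z → z occᴱ E → z ∈ V

  ⊆ᵛ-eliminate : ∀ {x t E V} → ((var x , t) ∷ E) ⊆ᵛ V → ¬ x occ t → (E ⟨ var [ x ↦ t ] ⟩) ⊆ᵛ (V ∖ x)
  ⊆ᵛ-eliminate {x} {t} {E} E⊆V x∉t z z∈Eσ
    with z′ , z′∈E , z∈σz′ ← occᴱ-⟨⟩⁻ E z∈Eσ | z′ ≟ x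
  ... | yes refl = ∈-∖ (E⊆V z (here (inj₂ z∈σz′))) λ { refl → x∉t z∈σz′ }
  ... | no z′≢x with refl ← occ-var z∈σz′ = ∈-∖ (E⊆V z (there z′∈E)) z′≢x

  ⊆ᵛ-decompose : ∀ {f} {ts us : Vec (Term S) (ar f)} {E V} →
                 ((fun f ts , fun f us) ∷ E) ⊆ᵛ V → (zipᴱ ts us ++ E) ⊆ᵛ V
  ⊆ᵛ-decompose {ts = ts} {us} E⊆V z z∈ with Any.++⁻ (zipᴱ ts us) z∈
  ... | inj₂ z∈E = E⊆V z (there z∈E)
  ... | inj₁ z∈zip with occᴱ-zip⁻ ts us z∈zip
  ...   | i , inj₁ z∈t = E⊆V z (here (inj₁ (there i z∈t)))
  ...   | i , inj₂ z∈u = E⊆V z (here (inj₂ (there i z∈u)))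

  ⊆ᵛ-orient : ∀ {l r E V} → ((l , r) ∷ E) ⊆ᵛ V → ((r , l) ∷ E) ⊆ᵛ V
  ⊆ᵛ-orient E⊆V z (here (inj₁ o)) = E⊆V z (here (inj₂ o))
  ⊆ᵛ-orient E⊆V z (here (inj₂ o)) = E⊆V z (here (inj₁ o))
  ⊆ᵛ-orient E⊆V z (there o)       = E⊆V z (there o)

  -- Robinson's algorithm, run on a unifiable problem so that it cannot fail.  It terminates by
  -- the lexicographic measure (number of variables, size), tracked by the fuel n and k.
  mutual
    mgu-fuel : ∀ n k V E → length V ≤ n → sizeᴱ E < k → E ⊆ᵛ V → ∀ τ → τ unifies E → HasMGU E
    mgu-fuel n k       V [] _ _ _ _ _ = var , [] , λ τ _ → τ , λ _ → refl
    mgu-fuel n (suc k) V ((var x , t) ∷ E) lv lk E⊆V τ (e ∷ es) =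
      solve-var n k V x t E lv (<-≤-trans (sizeᴱ-tail (var x) t E) (≤-pred lk)) E⊆V τ e es
    mgu-fuel n (suc k) V ((fun f ts , var y) ∷ E) lv lk E⊆V τ (e ∷ es) =
      Product.map₂ (orient-mgu E)
        (solve-var n k V y (fun f ts) E lv (<-≤-trans (sizeᴱ-tail (fun f ts) (var y) E) (≤-pred lk))
                   (⊆ᵛ-orient E⊆V) τ (sym e) es)
    mgu-fuel n (suc k) V ((fun f ts , fun g us) ∷ E) lv lk E⊆V τ (e ∷ es) with refl ← fun-injectiveˡ e =
      Product.map₂ (decompose-mgu ts us E)
        (mgu-fuel n k V (zipᴱ ts us ++ E) lv (<-≤-trans (sizeᴱ-decompose ts us E) (≤-pred lk))
                  (⊆ᵛ-decompose E⊆V) τ (All.++⁺ (unifies-zip⁺ ts us (fun-injectiveʳ e)) es))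

    solve-var : ∀ n k V x t E → length V ≤ n → sizeᴱ E < k → ((var x , t) ∷ E) ⊆ᵛ V →
                ∀ τ → τ x ≡ subst τ t → τ unifies E → HasMGU ((var x , t) ∷ E)
    solve-var n k V x (var y) E lv lk E⊆V τ e es with x ≟ y
    ... | yes refl = Product.map₂ (delete-mgu E) (mgu-fuel n k V E lv lk (λ z → E⊆V z ∘ there) τ es)
    ... | no  x≢y  = eliminate n V x (var y) E lv E⊆V (λ { here → x≢y refl }) τ e es
    solve-var n k V x (fun g us) E lv lk E⊆V τ e es =
      eliminate n V x (fun g us) E lv E⊆V (λ x∈t → occurs-check x∈t e) τ e es

    eliminate : ∀ n V x t E → length V ≤ n → ((var x , t) ∷ E) ⊆ᵛ V → ¬ x occ t →
                ∀ τ → τ x ≡ subst τ t → τ unifies E → HasMGU ((var x , t) ∷ E)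
    eliminate zero    []      x t E lv E⊆V x∉t τ e es = ⊥-elim (Any.¬Any[] (E⊆V x (here (inj₁ here))))
    eliminate (suc n) V       x t E lv E⊆V x∉t τ e es
      with θ , θ-mgu ← mgu-fuel n (suc (sizeᴱ (E ⟨ var [ x ↦ t ] ⟩))) (V ∖ x) (E ⟨ var [ x ↦ t ] ⟩)
                         (≤-pred (<-≤-trans (∖-shorter (E⊆V x (here (inj₁ here)))) lv)) ≤-refl
                         (⊆ᵛ-eliminate E⊆V x∉t) τ (unifies-⟨⟩⁺ (unifies-cong (sym ∘ absorb e) es))
      = θ ∘ₛ var [ x ↦ t ] , eliminate-mgu E x∉t θ-mgu

  ⊆ᵛ-vars : ∀ s t → ((s , t) ∷ []) ⊆ᵛ (vars s ++ vars t)
  ⊆ᵛ-vars s t z (here (inj₁ z∈s)) = ∈-++⁺ˡ (occ⇒∈vars s z∈s)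
  ⊆ᵛ-vars s t z (here (inj₂ z∈t)) = ∈-++⁺ʳ (vars s) (occ⇒∈vars t z∈t)

  unifiable⇒mgu : ∀ s t (τ : Subst S) → subst τ s ≡ subst τ t → ∃[ θ ] IsMGU θ s t
  unifiable⇒mgu s t τ e
    with θ , (θ-unifies ∷ []) , θ-general ←
           mgu-fuel _ _ (vars s ++ vars t) ((s , t) ∷ []) ≤-refl ≤-refl (⊆ᵛ-vars s t) τ (e ∷ [])
    = θ , θ-unifies , λ τ′ e′ → θ-general τ′ (e′ ∷ [])

module Interleaving where

  double : ℕ → ℕ
  double zero    = zero
  double (suc n) = suc (suc (double n))

  double-injective : Injective _≡_ _≡_ double
  double-injective {zero}  {zero}  _ = refl
  double-injective {suc m} {suc n} e = cong suc (double-injective (suc-injective (suc-injective e)))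

  suc∘double-injective : Injective _≡_ _≡_ (suc ∘ double)
  suc∘double-injective = double-injective ∘ suc-injective

  double≢suc∘double : ∀ m n → double m ≢ suc (double n)
  double≢suc∘double (suc m) (suc n) e = double≢suc∘double m n (suc-injective (suc-injective e))

  interleave : {A : Set} → (ℕ → A) → (ℕ → A) → ℕ → A
  interleave f g zero    = f zero
  interleave f g (suc n) = interleave g (f ∘ suc) n

  interleave-double : ∀ {A : Set} (f g : ℕ → A) n → interleave f g (double n) ≡ f n
  interleave-double f g zero    = refl
  interleave-double f g (suc n) = interleave-double (f ∘ suc) (g ∘ suc) n

  interleave-suc∘double : ∀ {A : Set} (f g : ℕ → A) n → interleave f g (suc (double n)) ≡ g n
  interleave-suc∘double f g = interleave-double g (f ∘ suc)

module Rewriting {S : Signature} (𝓡 : EGTRS S) where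
  open Signature S
  open EGTRS 𝓡
  open Terms
  open Unification using (unifiable⇒mgu)
  open Interleaving

  _⊨_ : Subst S → List (XAtom S) → Set
  σ ⊨ As = All (λ A → Ded (ThCR 𝓡) (substX σ A)) As

  ⊨-cong-occ : ∀ {σ τ As} → (∀ x → Any (x occX_) As → σ x ≡ τ x) → σ ⊨ As → τ ⊨ As
  ⊨-cong-occ h []                 = []
  ⊨-cong-occ h (_∷_ {A} σA σAs) =
    ≡.subst (Ded (ThCR 𝓡)) (substX-cong-occ A (λ x → h x ∘ here)) σA ∷ ⊨-cong-occ (λ x → h x ∘ there) σAs

  ⊨-⟨⟩⁻ : ∀ {σ τ} As → σ ⊨ map (substX τ) As → (σ ∘ₛ τ) ⊨ As
  ⊨-⟨⟩⁻ {σ} {τ} As = All.map (λ {A} → ≡.subst (Ded (ThCR 𝓡)) (sym (substX-∘ₛ σ τ A))) ∘ All.map⁻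

  ⊨-⟨⟩⁺ : ∀ {σ τ σ′} As → σ ∘ₛ τ ≗ σ′ → σ′ ⊨ As → σ ⊨ map (substX τ) As
  ⊨-⟨⟩⁺ {σ} {τ} As στ≗σ′ =
    All.map⁺ ∘ All.map (λ {A} → ≡.subst (Ded (ThCR 𝓡)) (trans (sym (substX-cong στ≗σ′ A)) (substX-∘ₛ σ τ A)))

  Active-subst : ∀ {σ : Subst S} {t p} → Active 𝓡 t p → Active 𝓡 (subst σ t) p
  Active-subst Λ = Λ
  Active-subst {σ} (arg {ts = ts} i i∈μ p) =
    arg i i∈μ (≡.subst (λ u → Active 𝓡 u _) (sym (lookup-substs σ ts i)) (Active-subst p))

  ∣-subst : ∀ {σ : Subst S} {t p w} → Active 𝓡 t p → t ∣ p ≡ just w → subst σ t ∣ p ≡ just (subst σ w)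
  ∣-subst Λ refl = refl
  ∣-subst {σ} {w = w} (arg {ts = ts} {q} i _ p) t∣p = begin
    fun _ (substs σ ts) ∣ (toℕ i ∷ q) ≡⟨ ∣-arg (substs σ ts) i q ⟩
    lookup (substs σ ts) i ∣ q        ≡⟨ cong (_∣ q) (lookup-substs σ ts i) ⟩
    subst σ (lookup ts i) ∣ q         ≡⟨ ∣-subst p (trans (sym (∣-arg ts i q)) t∣p) ⟩
    just (subst σ w)                  ∎
    where open ≡.≡-Reasoning

  []at-subst : ∀ {σ : Subst S} {t p} s → Active 𝓡 t p → subst σ (t [ s ]at p) ≡ subst σ t [ subst σ s ]at p
  []at-subst s Λ = refl
  []at-subst {σ} s (arg {f} {ts} {q} i _ p) = begin
    subst σ (fun f ts [ s ]at (toℕ i ∷ q))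
      ≡⟨ cong (subst σ) ([]at-arg ts i q s) ⟩
    fun f (substs σ (ts [ i ]≔ (lookup ts i [ s ]at q)))
      ≡⟨ cong (fun f) (substs-[]≔ σ ts i _) ⟩
    fun f (substs σ ts [ i ]≔ subst σ (lookup ts i [ s ]at q))
      ≡⟨ cong (λ u → fun f (substs σ ts [ i ]≔ u)) ([]at-subst s p) ⟩
    fun f (substs σ ts [ i ]≔ (subst σ (lookup ts i) [ subst σ s ]at q))
      ≡⟨ cong (λ u → fun f (substs σ ts [ i ]≔ (u [ subst σ s ]at q))) (sym (lookup-substs σ ts i)) ⟩
    fun f (substs σ ts [ i ]≔ (lookup (substs σ ts) i [ subst σ s ]at q))
      ≡⟨ sym ([]at-arg (substs σ ts) i q (subst σ s)) ⟩
    fun f (substs σ ts) [ subst σ s ]at (toℕ i ∷ q)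
      ∎
    where open ≡.≡-Reasoning

  var-position⇒occ : ∀ {t p x} → Active 𝓡 t p → t ∣ p ≡ just (var x) → x occ t
  var-position⇒occ Λ refl = here
  var-position⇒occ (arg {ts = ts} {q} i _ p) t∣p = there i (var-position⇒occ p (trans (sym (∣-arg ts i q)) t∣p))

  data Step : Term S → Term S → Set where
    root  : ∀ ρ → R ρ → ∀ σ → σ ⊨ map rm (Rule.cond ρ) → Step (subst σ (Rule.lhs ρ)) (subst σ (Rule.rhs ρ))
    under : ∀ {f ts} i → i Subset.∈ μ f → ∀ {u} → Step (lookup ts i) u → Step (fun f ts) (fun f (ts [ i ]≔ u))

  Step⇒→R : ∀ {s t} → Step s t → _→R_ 𝓡 s t
  Step⇒→R (root ρ ρ∈R σ σ⊨c) = by (rw-rule ρ ρ∈R σ) (All.map⁺ (All.map⁻ σ⊨c))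
  Step⇒→R (under {f} {ts} i i∈μ {u} s→u) = by (rw-cong f ts i i∈μ u) (Step⇒→R s→u ∷ [])

  →R⇒Step : ∀ {s t} → _→R_ 𝓡 s t → Step s t
  →R⇒Step (by (rw-rule ρ ρ∈R σ) σ⊨c)            = root ρ ρ∈R σ (All.map⁺ (All.map⁻ σ⊨c))
  →R⇒Step (by (rw-cong f ts i i∈μ u) (s→u ∷ [])) = under i i∈μ (→R⇒Step s→u)
  →R⇒Step (by (a ()) _)

  Step-at : ∀ {t p w w′} → Active 𝓡 t p → t ∣ p ≡ just w → Step w w′ → Step t (t [ w′ ]at p)
  Step-at Λ refl w→w′ = w→w′
  Step-at {w′ = w′} (arg {f} {ts} {q} i i∈μ p) t∣p w→w′ =
    ≡.subst (Step (fun f ts)) (sym ([]at-arg ts i q w′))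
      (under i i∈μ (Step-at p (trans (sym (∣-arg ts i q)) t∣p) w→w′))

  under′ : ∀ {f ts} i → i Subset.∈ μ f → ∀ {u v} → lookup ts i ≡ u → Step u v →
           Step (fun f ts) (fun f (ts [ i ]≔ v))
  under′ i i∈μ refl = under i i∈μ

  Step-arg : ∀ {f} (ts : Vec (Term S) (ar f)) i → i Subset.∈ μ f → ∀ {u v} →
             Step u v → Step (fun f (ts [ i ]≔ u)) (fun f (ts [ i ]≔ v))
  Step-arg {f} ts i i∈μ {u} {v} u→v =
    ≡.subst (Step _) (cong (fun f) (Vec.[]≔-idempotent ts i)) (under′ i i∈μ (Vec.lookup∘update i ts u) u→v)

  =E-arg : ∀ {f} (ts : Vec (Term S) (ar f)) i → i Subset.∈ μ f → ∀ {u v} →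
           _=E_ 𝓡 u v → _=E_ 𝓡 (fun f (ts [ i ]≔ u)) (fun f (ts [ i ]≔ v))
  =E-arg {f} ts i i∈μ {u} {v} u=v =
    ≡.subst (_=E_ 𝓡 _) (cong (fun f) (Vec.[]≔-idempotent ts i))
      (by (a (eq-cong f (ts [ i ]≔ u) i i∈μ v))
          (≡.subst (λ w → _=E_ 𝓡 w v) (sym (Vec.lookup∘update i ts u)) u=v ∷ []))

  =E-refl : ∀ t → _=E_ 𝓡 t t
  =E-refl t = by (a (eq-refl t)) []

  =E-sym : ∀ {t u} → _=E_ 𝓡 t u → _=E_ 𝓡 u t
  =E-sym {t} {u} t=u = by (a (eq-sym t u)) (t=u ∷ [])

  Joinable : Term S → Term S → Set
  Joinable t t′ = ∃[ u ] ∃[ u′ ] (_→R*_ 𝓡 t u × _→R*_ 𝓡 t′ u′ × _=E_ 𝓡 u u′)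

  Joinable-sym : ∀ {t t′} → Joinable t t′ → Joinable t′ t
  Joinable-sym (u , u′ , t→u , t′→u′ , u=u′) = u′ , u , t′→u′ , t→u , =E-sym u=u′

  Joinable-arg : ∀ {f} (ts : Vec (Term S) (ar f)) i → i Subset.∈ μ f → ∀ {t t′} →
                 Joinable t t′ → Joinable (fun f (ts [ i ]≔ t)) (fun f (ts [ i ]≔ t′))
  Joinable-arg ts i i∈μ (u , u′ , t→u , t′→u′ , u=u′) =
    plug u , plug u′ , gmap plug (Step⇒→R ∘ Step-arg ts i i∈μ ∘ →R⇒Step) t→u
                     , gmap plug (Step⇒→R ∘ Step-arg ts i i∈μ ∘ →R⇒Step) t′→u′ , =E-arg ts i i∈μ u=u′
    where
    plug : Term S → Term S
    plug w = fun _ (ts [ i ]≔ w)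

  Joinable-disjoint-args : ∀ {f} (ts : Vec (Term S) (ar f)) {i j} → i ≢ j → i Subset.∈ μ f → j Subset.∈ μ f →
                           ∀ {u v} → Step (lookup ts i) u → Step (lookup ts j) v →
                           Joinable (fun f (ts [ i ]≔ u)) (fun f (ts [ j ]≔ v))
  Joinable-disjoint-args {f} ts {i} {j} i≢j i∈μ j∈μ {u} {v} tsᵢ→u tsⱼ→v =
    _ , _ , Step⇒→R (under′ j j∈μ (Vec.lookup∘update′ (i≢j ∘ sym) ts u) tsⱼ→v) ◅ ε
          , Step⇒→R (under′ i i∈μ (Vec.lookup∘update′ i≢j ts v) tsᵢ→u) ◅ ε
          , ≡.subst (_=E_ 𝓡 _) (cong (fun f) (Vec.[]≔-commutes ts i j i≢j)) (=E-refl _)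

  record StepAtFunPos (l : Term S) (σ : Subst S) (t′ : Term S) : Set where
    field
      p        : Pos
      f        : F
      ts       : Vec (Term S) (ar f)
      p-active : Active 𝓡 l p
      l∣p      : l ∣ p ≡ just (fun f ts)
      ρ₂       : Rule S
      ρ₂∈R     : R ρ₂
      σ₂       : Subst S
      σ₂⊨      : σ₂ ⊨ map rm (Rule.cond ρ₂)
      matches  : subst σ (fun f ts) ≡ subst σ₂ (Rule.lhs ρ₂)
      result   : t′ ≡ subst σ l [ subst σ₂ (Rule.rhs ρ₂) ]at p

  record StepBelowVar (l : Term S) (σ : Subst S) (t′ : Term S) : Set where
    field
      x        : ℕ
      p        : Pos
      v        : Term S
      p-active : Active 𝓡 l p
      l∣p      : l ∣ p ≡ just (var x)
      σx→v     : Step (σ x) v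
      result   : t′ ≡ subst σ l [ v ]at p

  private
    result-arg : ∀ {f} (ls : Vec (Term S) (ar f)) i (σ : Subst S) {u w} q → u ≡ subst σ (lookup ls i) [ w ]at q →
                 fun f (substs σ ls [ i ]≔ u) ≡ subst σ (fun f ls) [ w ]at (toℕ i ∷ q)
    result-arg {f} ls i σ {u} {w} q u≡ = begin
      fun f (substs σ ls [ i ]≔ u)
        ≡⟨ cong (λ z → fun f (substs σ ls [ i ]≔ z)) u≡ ⟩
      fun f (substs σ ls [ i ]≔ (subst σ (lookup ls i) [ w ]at q))
        ≡⟨ cong (λ z → fun f (substs σ ls [ i ]≔ (z [ w ]at q))) (sym (lookup-substs σ ls i)) ⟩
      fun f (substs σ ls [ i ]≔ (lookup (substs σ ls) i [ w ]at q))
        ≡⟨ sym ([]at-arg (substs σ ls) i q w) ⟩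
      fun f (substs σ ls) [ w ]at (toℕ i ∷ q)
        ∎
      where open ≡.≡-Reasoning

  StepAtFunPos-arg : ∀ {g} (ls : Vec (Term S) (ar g)) i → i Subset.∈ μ g → ∀ {σ u} →
                     StepAtFunPos (lookup ls i) σ u → StepAtFunPos (fun g ls) σ (fun g (substs σ ls [ i ]≔ u))
  StepAtFunPos-arg ls i i∈μ {σ} O = record
    { p = toℕ i ∷ p ; f = f ; ts = ts ; p-active = arg i i∈μ p-active ; l∣p = trans (∣-arg ls i p) l∣p
    ; ρ₂ = ρ₂ ; ρ₂∈R = ρ₂∈R ; σ₂ = σ₂ ; σ₂⊨ = σ₂⊨ ; matches = matches ; result = result-arg ls i σ p result }
    where open StepAtFunPos O

  StepBelowVar-arg : ∀ {g} (ls : Vec (Term S) (ar g)) i → i Subset.∈ μ g → ∀ {σ u} →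
                     StepBelowVar (lookup ls i) σ u → StepBelowVar (fun g ls) σ (fun g (substs σ ls [ i ]≔ u))
  StepBelowVar-arg ls i i∈μ {σ} V = record
    { x = x ; p = toℕ i ∷ p ; v = v ; p-active = arg i i∈μ p-active ; l∣p = trans (∣-arg ls i p) l∣p
    ; σx→v = σx→v ; result = result-arg ls i σ p result }
    where open StepBelowVar V

  instance-step-view : ∀ l σ {s t′} → s ≡ subst σ l → Step s t′ → StepAtFunPos l σ t′ ⊎ StepBelowVar l σ t′
  instance-step-view (var x) σ {t′ = t′} refl s→t′ =
    inj₂ (record { x = x ; p = [] ; v = t′ ; p-active = Λ ; l∣p = refl ; σx→v = s→t′ ; result = refl })
  instance-step-view (fun f ls) σ s≡σl (root ρ ρ∈R σ₂ σ₂⊨c) =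
    inj₁ (record { p = [] ; f = f ; ts = ls ; p-active = Λ ; l∣p = refl ; ρ₂ = ρ ; ρ₂∈R = ρ∈R ; σ₂ = σ₂
                 ; σ₂⊨ = σ₂⊨c ; matches = sym s≡σl ; result = refl })
  instance-step-view (fun f ls) σ refl (under i i∈μ sᵢ→u)
    with instance-step-view (lookup ls i) σ (lookup-substs σ ls i) sᵢ→u
  ... | inj₁ O = inj₁ (StepAtFunPos-arg ls i i∈μ O)
  ... | inj₂ V = inj₂ (StepBelowVar-arg ls i i∈μ V)

  module _ (pairs-joinable : AllPairsJoinable 𝓡) where

    -- Rename the two rules apart into even and odd variables; the interleaving of σ₁ and σ₂
    -- then unifies the overlap, so an mgu exists and the critical pair covers this peak.
    critical-peak : ∀ {ρ₁ σ₁ t′} → R ρ₁ → σ₁ ⊨ map rm (Rule.cond ρ₁) → StepAtFunPos (Rule.lhs ρ₁) σ₁ t′ →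
                    Joinable (subst σ₁ (Rule.rhs ρ₁)) t′
    critical-peak {ρ₁} {σ₁} {t′} ρ₁∈R σ₁⊨c O =
      Joinable-sym (≡.subst₂ Joinable left right (pairs-joinable _ (inj₁ pair) ρ ρ⊨))
      where
      open StepAtFunPos O

      κ₁ κ₂ τ : Subst S
      κ₁ = var ∘ double
      κ₂ = var ∘ suc ∘ double
      τ  = interleave σ₁ σ₂

      τ-unifies : subst τ (subst κ₁ (fun f ts)) ≡ subst τ (subst κ₂ (Rule.lhs ρ₂))
      τ-unifies = begin
        subst τ (subst κ₁ (fun f ts))      ≡⟨ sym (subst-∘ₛ τ κ₁ (fun f ts)) ⟩
        subst (τ ∘ₛ κ₁) (fun f ts)         ≡⟨ subst-cong (interleave-double σ₁ σ₂) (fun f ts) ⟩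
        subst σ₁ (fun f ts)                ≡⟨ matches ⟩
        subst σ₂ (Rule.lhs ρ₂)             ≡⟨ sym (subst-cong (interleave-suc∘double σ₁ σ₂) (Rule.lhs ρ₂)) ⟩
        subst (τ ∘ₛ κ₂) (Rule.lhs ρ₂)      ≡⟨ subst-∘ₛ τ κ₂ (Rule.lhs ρ₂) ⟩
        subst τ (subst κ₂ (Rule.lhs ρ₂))   ∎
        where open ≡.≡-Reasoning

      mgu = unifiable⇒mgu (subst κ₁ (fun f ts)) (subst κ₂ (Rule.lhs ρ₂)) τ τ-unifies
      θ = proj₁ mgu
      ρ = proj₁ (proj₂ (proj₂ mgu) τ τ-unifies)

      τ≗ρθ : τ ≗ ρ ∘ₛ θ
      τ≗ρθ = proj₂ (proj₂ (proj₂ mgu) τ τ-unifies)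

      ρθκ₁≗σ₁ : (ρ ∘ₛ θ) ∘ₛ κ₁ ≗ σ₁
      ρθκ₁≗σ₁ y = trans (sym (τ≗ρθ (double y))) (interleave-double σ₁ σ₂ y)

      ρθκ₂≗σ₂ : (ρ ∘ₛ θ) ∘ₛ κ₂ ≗ σ₂
      ρθκ₂≗σ₂ y = trans (sym (τ≗ρθ (suc (double y)))) (interleave-suc∘double σ₁ σ₂ y)

      back : ∀ {κ σ′} → (ρ ∘ₛ θ) ∘ₛ κ ≗ σ′ → ∀ t → subst ρ (subst θ (subst κ t)) ≡ subst σ′ t
      back {κ} ρθκ≗σ′ t = trans (sym (subst-∘ₛ-∘ₛ ρ θ κ t)) (subst-cong ρθκ≗σ′ t)

      ρ⊨ = All.++⁺ (⊨-⟨⟩⁺ _ (λ _ → refl) (⊨-⟨⟩⁺ _ ρθκ₁≗σ₁ σ₁⊨c)) (⊨-⟨⟩⁺ _ (λ _ → refl) (⊨-⟨⟩⁺ _ ρθκ₂≗σ₂ σ₂⊨))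

      disjoint : ∀ x → x occR substRm κ₁ (toRm ρ₁) → ¬ x occR substRm κ₂ (toRm ρ₂)
      disjoint x x∈α₁ x∈α₂
        with z₁ , x∈κ₁z₁ ← occR-substRm⁻ (toRm ρ₁) x∈α₁ | z₂ , x∈κ₂z₂ ← occR-substRm⁻ (toRm ρ₂) x∈α₂
        = double≢suc∘double z₁ z₂ (trans (sym (occ-var x∈κ₁z₁)) (occ-var x∈κ₂z₂))

      pair = ccp ρ₁ ρ₂ ρ₁∈R ρ₂∈R double (suc ∘ double) double-injective suc∘double-injective disjoint
                 p (subst κ₁ (fun f ts)) (Active-subst p-active , f , substs κ₁ ts , ∣-subst p-active l∣p)
                 (∣-subst p-active l∣p) θ (proj₂ mgu) (ρ , ρ⊨)

      left : subst ρ (subst θ (subst κ₁ (Rule.lhs ρ₁)) [ subst θ (subst κ₂ (Rule.rhs ρ₂)) ]at p) ≡ t′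
      left = begin
        subst ρ (subst θ (subst κ₁ (Rule.lhs ρ₁)) [ subst θ (subst κ₂ (Rule.rhs ρ₂)) ]at p)
          ≡⟨ []at-subst _ (Active-subst (Active-subst p-active)) ⟩
        subst ρ (subst θ (subst κ₁ (Rule.lhs ρ₁))) [ subst ρ (subst θ (subst κ₂ (Rule.rhs ρ₂))) ]at p
          ≡⟨ cong₂ (λ s u → s [ u ]at p) (back ρθκ₁≗σ₁ (Rule.lhs ρ₁)) (back ρθκ₂≗σ₂ (Rule.rhs ρ₂)) ⟩
        subst σ₁ (Rule.lhs ρ₁) [ subst σ₂ (Rule.rhs ρ₂) ]at p
          ≡⟨ sym result ⟩
        t′ ∎
        where open ≡.≡-Reasoning

      right : subst ρ (subst θ (subst κ₁ (Rule.rhs ρ₁))) ≡ subst σ₁ (Rule.rhs ρ₁)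
      right = back ρθκ₁≗σ₁ (Rule.rhs ρ₁)

    -- Instantiating a fresh x′ to v turns the condition x → x′ of the variable pair into σ x → v.
    variable-peak : ∀ {ρ σ t′} → R ρ → σ ⊨ map rm (Rule.cond ρ) → StepBelowVar (Rule.lhs ρ) σ t′ →
                    Joinable (subst σ (Rule.rhs ρ)) t′
    variable-peak {ρ} {σ} {t′} ρ∈R σ⊨c V =
      Joinable-sym (≡.subst₂ Joinable left right (pairs-joinable _ (inj₂ pair) σ′ σ′⊨))
      where
      open StepBelowVar V

      x′ = proj₁ (fresh-var (toRm ρ))
      σ′ = σ [ x′ ↦ v ]

      σ′≈σ : ∀ y → y occR toRm ρ → σ′ y ≡ σ y
      σ′≈σ y y∈ρ = [↦]-≢ σ x′ v λ { refl → proj₂ (fresh-var (toRm ρ)) y∈ρ }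

      σ′⊨ : σ′ ⊨ ((var x ⟶ var x′) ∷ map rm (Rule.cond ρ))
      σ′⊨ = ≡.subst₂ (λ a b → Ded (ThCR 𝓡) (a ⟶ b)) (sym (σ′≈σ x (inj₁ (var-position⇒occ p-active l∣p))))
                      (sym ([↦]-≡ σ x′ v)) (Step⇒→R σx→v)
          ∷ ⊨-cong-occ (λ y y∈c → sym (σ′≈σ y (inj₂ (inj₂ y∈c)))) σ⊨c

      pair = cvp ρ ρ∈R x p (p-active , l∣p) x′ (proj₂ (fresh-var (toRm ρ))) (σ′ , σ′⊨)

      left : subst σ′ (Rule.lhs ρ [ var x′ ]at p) ≡ t′
      left = begin
        subst σ′ (Rule.lhs ρ [ var x′ ]at p)   ≡⟨ []at-subst (var x′) p-active ⟩
        subst σ′ (Rule.lhs ρ) [ σ′ x′ ]at p    ≡⟨ cong₂ (λ s u → s [ u ]at p) σ′ℓ≡σℓ ([↦]-≡ σ x′ v) ⟩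
        subst σ (Rule.lhs ρ) [ v ]at p         ≡⟨ sym result ⟩
        t′                                     ∎
        where
        open ≡.≡-Reasoning
        σ′ℓ≡σℓ : subst σ′ (Rule.lhs ρ) ≡ subst σ (Rule.lhs ρ)
        σ′ℓ≡σℓ = subst-cong-occ (Rule.lhs ρ) (λ y → σ′≈σ y ∘ inj₁)

      right : subst σ′ (Rule.rhs ρ) ≡ subst σ (Rule.rhs ρ)
      right = subst-cong-occ (Rule.rhs ρ) (λ y → σ′≈σ y ∘ inj₂ ∘ inj₁)

    root-peak : ∀ {ρ σ t′} → R ρ → σ ⊨ map rm (Rule.cond ρ) → Step (subst σ (Rule.lhs ρ)) t′ →
                Joinable (subst σ (Rule.rhs ρ)) t′
    root-peak {ρ} {σ} ρ∈R σ⊨c s→t′ with instance-step-view (Rule.lhs ρ) σ refl s→t′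
    ... | inj₁ O = critical-peak ρ∈R σ⊨c O
    ... | inj₂ V = variable-peak ρ∈R σ⊨c V

    mutual
      peak : ∀ {s t t′} → Step s t → Step s t′ → Joinable t t′
      peak (root ρ ρ∈R σ σ⊨c) s→t′ = root-peak ρ∈R σ⊨c s→t′
      peak (under i i∈μ sᵢ→u) s→t′ = under-peak i i∈μ sᵢ→u refl s→t′

      under-peak : ∀ {f ts} i → i Subset.∈ μ f → ∀ {u s t′} → Step (lookup ts i) u → s ≡ fun f ts → Step s t′ →
                   Joinable (fun f (ts [ i ]≔ u)) t′
      under-peak i i∈μ sᵢ→u s≡ (root ρ ρ∈R σ σ⊨c) =
        Joinable-sym (root-peak ρ∈R σ⊨c (≡.subst (λ s → Step s _) (sym s≡) (under i i∈μ sᵢ→u)))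
      under-peak {ts = ts} i i∈μ sᵢ→u refl (under j j∈μ sⱼ→u′) with i Fin.≟ j
      ... | yes refl = Joinable-arg ts i i∈μ (peak sᵢ→u sⱼ→u′)
      ... | no  i≢j  = Joinable-disjoint-args ts i≢j i∈μ j∈μ sᵢ→u sⱼ→u′

    pairs-joinable⇒α : PropertyAlpha 𝓡
    pairs-joinable⇒α s t t′ s→t s→t′ = peak (→R⇒Step s→t) (→R⇒Step s→t′)

  renamed-root-step : ∀ {ρ} → R ρ → ∀ κ θ σ → σ ⊨ map (substX θ) (RmRule.cond (substRm κ (toRm ρ))) →
                      Step (subst σ (subst θ (subst κ (Rule.lhs ρ)))) (subst σ (subst θ (subst κ (Rule.rhs ρ))))
  renamed-root-step {ρ} ρ∈R κ θ σ σ⊨c =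
    ≡.subst₂ Step (subst-∘ₛ-∘ₛ σ θ κ (Rule.lhs ρ)) (subst-∘ₛ-∘ₛ σ θ κ (Rule.rhs ρ))
      (root ρ ρ∈R ((σ ∘ₛ θ) ∘ₛ κ) (⊨-⟨⟩⁻ _ (⊨-⟨⟩⁻ _ σ⊨c)))

  α⇒pairs-joinable : PropertyAlpha 𝓡 → AllPairsJoinable 𝓡
  α⇒pairs-joinable α _ (inj₁ (ccp ρ₁ ρ₂ ρ₁∈R ρ₂∈R π₁ π₂ _ _ _ p _ (p-active , _) l∣p θ (θ-unifies , _) _)) σ σ⊨ =
    α _ _ _ (Step⇒→R inner) (Step⇒→R outer)
    where
    κ₁ κ₂ : Subst S
    κ₁ = var ∘ π₁
    κ₂ = var ∘ π₂

    c₁ : List (XAtom S)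
    c₁ = map (substX θ) (RmRule.cond (substRm κ₁ (toRm ρ₁)))

    outer : Step (subst σ (subst θ (subst κ₁ (Rule.lhs ρ₁)))) (subst σ (subst θ (subst κ₁ (Rule.rhs ρ₁))))
    outer = renamed-root-step ρ₁∈R κ₁ θ σ (All.++⁻ˡ c₁ σ⊨)

    σθℓ₁∣p : subst σ (subst θ (subst κ₁ (Rule.lhs ρ₁))) ∣ p ≡ just (subst σ (subst θ (subst κ₂ (Rule.lhs ρ₂))))
    σθℓ₁∣p = trans (∣-subst (Active-subst p-active) (∣-subst p-active l∣p)) (cong (just ∘ subst σ) θ-unifies)

    inner : Step (subst σ (subst θ (subst κ₁ (Rule.lhs ρ₁))))
                 (subst σ (subst θ (subst κ₁ (Rule.lhs ρ₁)) [ subst θ (subst κ₂ (Rule.rhs ρ₂)) ]at p))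
    inner = ≡.subst (Step _) (sym ([]at-subst _ (Active-subst p-active)))
              (Step-at (Active-subst (Active-subst p-active)) σθℓ₁∣p
                       (renamed-root-step ρ₂∈R κ₂ θ σ (All.++⁻ʳ c₁ σ⊨)))
  α⇒pairs-joinable α _ (inj₂ (cvp ρ ρ∈R x p (p-active , l∣p) x′ _ _)) σ (σx→σx′ ∷ σ⊨c) =
    α _ _ _ (Step⇒→R inner) (Step⇒→R (root ρ ρ∈R σ σ⊨c))
    where
    inner : Step (subst σ (Rule.lhs ρ)) (subst σ (Rule.lhs ρ [ var x′ ]at p))
    inner = ≡.subst (Step _) (sym ([]at-subst (var x′) p-active))
              (Step-at (Active-subst p-active) (∣-subst p-active l∣p) (→R⇒Step σx→σx′))

proposition8p10 : (S : Signature) (𝓡 : EGTRS S) →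
    PropertyAlpha 𝓡 ⇔ AllPairsJoinable 𝓡
proposition8p10 S 𝓡 = mk⇔ α⇒pairs-joinable pairs-joinable⇒α
  where open Rewriting 𝓡
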